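{- Let $q>4$ be an integer. For any distinct $x,y,z\in\mathbb{Z}_q$ there exists an $\mathcal{OS}_q(2)$ of maximal period (i.e.\ of period $q(q-1)/2$ if $q$ is odd and $q(q-2)/2$ if $q$ is even) whose ring sequence has the form $[x,y,z,x,\ldots]$. Moreover, if $x,y,z\neq 0$, then there exists an $\mathcal{OS}_q(2)$ of maximal period whose ring sequence has the form $[0,x,y,z,x,\ldots]$.
   Context: Sequences are periodic with entries in $\mathbb{Z}_q$, described by their ring sequence (one period, listed from a chosen starting position). Write $\mathbf{s}_n(i)=(s_i,\ldots,s_{i+n-1})$ and $\mathbf{u}^R$ for the reverse of a tuple $\mathbf{u}$. An $\mathcal{OS}_q(n)$ (orientable sequence of order $n$) of period $m$ is a periodic sequence such that $\mathbf{s}_n(i)=\mathbf{s}_n(j)$ implies $i\equiv j\pmod m$, and $\mathbf{s}_n(i)\neq\mathbf{s}_n(j)^R$ for all $i,j$. -}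

module Defs where

open import Data.Nat using (ℕ; zero; suc; _+_; _*_; _∸_; NonZero)
open import Data.Nat.DivMod using (_/_; _%_; _mod_)
open import Data.Fin using (Fin)
open import Data.Vec using (Vec; lookup; tabulate; reverse)
open import Data.Fin using (toℕ)
open import Data.Product using (Σ; _×_)
open import Relation.Binary.PropositionalEquality using (_≡_; _≢_)

-- Periodic sequence with ring sequence v (one period of length m): entry s_i.
entry : ∀ {A : Set} {m : ℕ} {{_ : NonZero m}} → Vec A m → ℕ → A
entry {m = m} v i = lookup v (i mod m)

window : ∀ {A : Set} {m : ℕ} {{_ : NonZero m}} → (n : ℕ) → Vec A m → ℕ → Vec A n
window n v i = tabulate (λ k → entry v (i + toℕ k))

IsOSWith : ∀ {q m : ℕ} {{_ : NonZero m}} → (n : ℕ) → Vec (Fin q) m → Set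
IsOSWith {m = m} n v =
  (∀ i j → window n v i ≡ window n v j → i % m ≡ j % m)
  × (∀ i j → window n v i ≢ reverse (window n v j))

IsOS : ∀ {q m : ℕ} → (n : ℕ) → Vec (Fin q) m → Set
IsOS {m = m} n v = Σ (NonZero m) λ nz → IsOSWith {{nz}} n v

maxPeriod : ℕ → ℕ
maxPeriod q with q % 2
... | zero  = (q * (q ∸ 2)) / 2
... | suc _ = (q * (q ∸ 1)) / 2

{-# OPTIONS --safe #-}
module Submission where

-- Read cyclically, an OS_q(2) of period m is a closed trail of length m in the complete graph K_q:
-- its windows are the traversed edges, and a window equal to the reverse of a window is a repeated
-- undirected edge or a loop.  Closed trails of the maximal length exist: an Euler circuit of K_q
-- for odd q, and one of K_q minus a perfect matching for even q.  For q = 5 and q = 6 they are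
-- written down and checked by evaluation; passing from q to q + 2, a detour through 0 is spliced in
-- that zigzags between the new vertices q and q + 1, using every edge from them to the old vertices
-- (and q—(q+1) when q is odd).  The base trails start 0 1 2 0 and 0 1 2 3 1, and an injective
-- relabelling that sends 0 1 2 to x y z, respectively 0 1 2 3 to 0 x y z, produces the required
-- starts.

open import Defs
open import Data.Empty using (⊥-elim)
open import Data.Fin as Fin using (Fin; zero; toℕ)
open import Data.Fin.Properties using (toℕ-injective; toℕ<n; fromℕ<-cong; fromℕ<-toℕ; fromℕ<-injective)
open import Data.List using (List; []; _∷_; _++_; _∷ʳ_; map; length; applyUpTo)
open import Data.List.Properties
  using (++-assoc; length-++; length-map; map-++; map-∘; map-id; map-id-local; map-cong; applyUpTo-∷ʳ;
         ∷-injectiveˡ; ∷-injectiveʳ)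
open import Data.List.Relation.Unary.All as All using (All; []; _∷_; all?)
import Data.List.Relation.Unary.All.Properties as All
open import Data.List.Relation.Unary.AllPairs as AllPairs using (AllPairs; []; _∷_; allPairs?)
import Data.List.Relation.Unary.AllPairs.Properties as AllPairs
open import Data.List.Relation.Unary.Unique.Propositional using (Unique)
import Data.List.Relation.Unary.Unique.Propositional.Properties as Unique
open import Data.Nat
  using (ℕ; zero; suc; _+_; _*_; _≤_; _<_; z≤n; s≤s; z<s; s<s; NonZero; >-nonZero⁻¹; _<?_; _≟_)
open import Data.Nat.DivMod
open import Data.Nat.Properties
open import Data.Nat.Tactic.RingSolver using (solve-∀)
open import Data.Product as Product using (Σ; _×_; _,_; proj₁; proj₂; ∃)
open import Data.Sum using (_⊎_; inj₁; inj₂)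
open import Data.Vec as Vec using (Vec; toList; fromList; lookup)
import Data.Vec.Properties as Vec
open import Function using (_∘_; id)
open import Relation.Binary.Definitions using (DecidableEquality; tri<; tri≈; tri>)
open import Relation.Binary.PropositionalEquality
open import Relation.Nullary using (¬_; Dec; yes; no; ¬?)
open import Relation.Nullary.Decidable using (_×-dec_; _⊎-dec_; True; toWitness)
open import Relation.Unary using (∁)

-- Undirected edges and trails

module _ {A : Set} where

  SameEdge : A × A → A × A → Set
  SameEdge (a , b) (c , d) = (a ≡ c × b ≡ d) ⊎ (a ≡ d × b ≡ c)

  _≉_ : A × A → A × A → Set
  e ≉ f = ¬ SameEdge e f

  NonLoop : A × A → Set
  NonLoop (a , b) = a ≢ b

  IsSimple : List (A × A) → Set
  IsSimple E = AllPairs _≉_ E × All NonLoop E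

  Any₂ All₂ : (A → Set) → A × A → Set
  Any₂ P (a , b) = P a ⊎ P b
  All₂ P (a , b) = P a × P b

  edges : List A → List (A × A)
  edges []          = []
  edges (a ∷ [])    = []
  edges (a ∷ b ∷ w) = (a , b) ∷ edges (b ∷ w)

  ≉-sym : ∀ {e f} → e ≉ f → f ≉ e
  ≉-sym e≉f (inj₁ (refl , refl)) = e≉f (inj₁ (refl , refl))
  ≉-sym e≉f (inj₂ (refl , refl)) = e≉f (inj₂ (refl , refl))

  endpoint-apart : ∀ {P : A → Set} {e f} → Any₂ P e → All₂ (∁ P) f → e ≉ f
  endpoint-apart (inj₁ Pa) (¬Pc , _)   (inj₁ (refl , _)) = ¬Pc Pa
  endpoint-apart (inj₁ Pa) (_   , ¬Pd) (inj₂ (refl , _)) = ¬Pd Pa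
  endpoint-apart (inj₂ Pb) (_   , ¬Pd) (inj₁ (_ , refl)) = ¬Pd Pb
  endpoint-apart (inj₂ Pb) (¬Pc , _)   (inj₂ (_ , refl)) = ¬Pc Pb

  IsSimple-∷ : ∀ {e E} → NonLoop e → All (e ≉_) E → IsSimple E → IsSimple (e ∷ E)
  IsSimple-∷ e-nonLoop e-apart (apart , nonLoop) = e-apart ∷ apart , e-nonLoop ∷ nonLoop

  IsSimple-++ : ∀ {E F} → IsSimple E → IsSimple F → All (λ e → All (e ≉_) F) E → IsSimple (E ++ F)
  IsSimple-++ (apartE , nonLoopE) (apartF , nonLoopF) apartEF =
    AllPairs.++⁺ apartE apartF apartEF , All.++⁺ nonLoopE nonLoopF

  isSimple? : DecidableEquality A → ∀ E → Dec (IsSimple E)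
  isSimple? _≟ᴬ_ E = allPairs? (λ e f → ¬? (sameEdge? e f)) E ×-dec all? (λ (a , b) → ¬? (a ≟ᴬ b)) E
    where
    sameEdge? : ∀ e f → Dec (SameEdge e f)
    sameEdge? (a , b) (c , d) = (a ≟ᴬ c ×-dec b ≟ᴬ d) ⊎-dec (a ≟ᴬ d ×-dec b ≟ᴬ c)

  edges-++ : ∀ xs y ys → edges (xs ++ y ∷ ys) ≡ edges (xs ∷ʳ y) ++ edges (y ∷ ys)
  edges-++ []            y ys = refl
  edges-++ (x ∷ [])      y ys = refl
  edges-++ (x ∷ x′ ∷ xs) y ys = cong ((x , x′) ∷_) (edges-++ (x′ ∷ xs) y ys)

  edges-All : ∀ {P : A → Set} {w} → All P w → All (All₂ P) (edges w)
  edges-All []             = []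
  edges-All (_ ∷ [])       = []
  edges-All (Pa ∷ Pb ∷ Pw) = (Pa , Pb) ∷ edges-All (Pb ∷ Pw)

  edges-applyUpTo : ∀ (f : ℕ → A) n → edges (applyUpTo f (suc n)) ≡ applyUpTo (λ i → f i , f (suc i)) n
  edges-applyUpTo f zero    = refl
  edges-applyUpTo f (suc n) = cong ((f 0 , f 1) ∷_) (edges-applyUpTo (f ∘ suc) n)

module _ {A B : Set} {Q : A → Set} {f : A → B}
         (injective : ∀ {u v} → Q u → Q v → f u ≡ f v → u ≡ v) where

  private
    f₂ : A × A → B × B
    f₂ = Product.map f f

    ≉-map : ∀ {e e′} → All₂ Q e → All₂ Q e′ → e ≉ e′ → f₂ e ≉ f₂ e′
    ≉-map (Qa , Qb) (Qc , Qd) e≉e′ (inj₁ (p , q)) = e≉e′ (inj₁ (injective Qa Qc p , injective Qb Qd q))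
    ≉-map (Qa , Qb) (Qc , Qd) e≉e′ (inj₂ (p , q)) = e≉e′ (inj₂ (injective Qa Qd p , injective Qb Qc q))

    IsSimple-map₂ : ∀ {E} → All (All₂ Q) E → IsSimple E → IsSimple (map f₂ E)
    IsSimple-map₂ []        _ = [] , []
    IsSimple-map₂ (Qe ∷ QE) (e-apart ∷ apart , e-nonLoop ∷ nonLoop) =
      IsSimple-∷ (e-nonLoop ∘ injective (proj₁ Qe) (proj₂ Qe))
                 (All.map⁺ (All.zipWith (λ (Qe′ , e≉e′) → ≉-map Qe Qe′ e≉e′) (QE , e-apart)))
                 (IsSimple-map₂ QE (apart , nonLoop))

    edges-map : ∀ w → edges (map f w) ≡ map f₂ (edges w)
    edges-map []          = refl
    edges-map (a ∷ [])    = refl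
    edges-map (a ∷ b ∷ w) = cong (f₂ (a , b) ∷_) (edges-map (b ∷ w))

  IsSimple-map : ∀ {w} → All Q w → IsSimple (edges w) → IsSimple (edges (map f w))
  IsSimple-map {w} Qw simple = subst IsSimple (sym (edges-map w)) (IsSimple-map₂ (edges-All Qw) simple)

-- Closed trails and orientable sequences

AllPairs-applyUpTo⁻ : ∀ {A : Set} {R : A → A → Set} (f : ℕ → A) n → AllPairs R (applyUpTo f n) →
                      ∀ {i j} → i < j → j < n → R (f i) (f j)
AllPairs-applyUpTo⁻ f (suc n) (Rf₀ ∷ _) {zero} {suc j} _ (s<s j<n) =
  All.applyUpTo⁻ (f ∘ suc) n Rf₀ j<n
AllPairs-applyUpTo⁻ f (suc n) (_ ∷ Rfs) {suc i} {suc j} (s<s i<j) (s<s j<n) =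
  AllPairs-applyUpTo⁻ (f ∘ suc) n Rfs i<j j<n

toList-applyUpTo : ∀ {A : Set} {n} (v : Vec A n) (f : ℕ → A) → (∀ k → f (toℕ k) ≡ lookup v k) →
                   toList v ≡ applyUpTo f n
toList-applyUpTo Vec.[]      f f≡v = refl
toList-applyUpTo (a Vec.∷ v) f f≡v =
  cong₂ _∷_ (sym (f≡v zero)) (toList-applyUpTo v (f ∘ suc) (f≡v ∘ Fin.suc))

toℕ-mod : ∀ {n} .{{_ : NonZero n}} (k : Fin n) → toℕ k mod n ≡ k
toℕ-mod k = trans (fromℕ<-cong _ _ (m<n⇒m%n≡m (toℕ<n k)) _ (toℕ<n k)) (fromℕ<-toℕ k (toℕ<n k))

mod-injective : ∀ {n} .{{_ : NonZero n}} {u v} → u < n → v < n → u mod n ≡ v mod n → u ≡ v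
mod-injective {n} {u} {v} u<n v<n eq = begin
  u     ≡⟨ m<n⇒m%n≡m u<n ⟨
  u % n ≡⟨ fromℕ<-injective _ _ (m%n<n u n) (m%n<n v n) eq ⟩
  v % n ≡⟨ m<n⇒m%n≡m v<n ⟩
  v     ∎
  where open ≡-Reasoning

module _ {A : Set} {m : ℕ} {{_ : NonZero m}} (v : Vec A m) where

  entry-cong : ∀ {i j} → i % m ≡ j % m → entry v i ≡ entry v j
  entry-cong {i} {j} eq = cong (lookup v) (fromℕ<-cong _ _ eq (m%n<n i m) (m%n<n j m))

  entry-suc-% : ∀ i → entry v (suc (i % m)) ≡ entry v (suc i)
  entry-suc-% i = entry-cong (sym (begin
    suc i % m                     ≡⟨ cong (λ k → suc k % m) (m≡m%n+[m/n]*n i m) ⟩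
    (suc (i % m) + i / m * m) % m ≡⟨ [m+kn]%n≡m%n (suc (i % m)) (i / m) m ⟩
    suc (i % m) % m               ∎))
    where open ≡-Reasoning

  window-2 : ∀ i → window 2 v i ≡ entry v i Vec.∷ entry v (suc i) Vec.∷ Vec.[]
  window-2 i = cong₂ (λ a b → a Vec.∷ b Vec.∷ Vec.[])
                     (cong (entry v) (+-identityʳ i)) (cong (entry v) (+-comm i 1))

  toList-cyclic : toList v ∷ʳ entry v 0 ≡ applyUpTo (entry v) (suc m)
  toList-cyclic = begin
    toList v ∷ʳ entry v 0              ≡⟨ cong₂ _∷ʳ_ toList≡ (entry-cong 0%m≡m%m) ⟩
    applyUpTo (entry v) m ∷ʳ entry v m ≡⟨ applyUpTo-∷ʳ (entry v) m ⟩
    applyUpTo (entry v) (suc m)        ∎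
    where
    open ≡-Reasoning
    toList≡ : toList v ≡ applyUpTo (entry v) m
    toList≡ = toList-applyUpTo v (entry v) (cong (lookup v) ∘ toℕ-mod)
    0%m≡m%m : 0 % m ≡ m % m
    0%m≡m%m = trans (m<n⇒m%n≡m (>-nonZero⁻¹ m)) (sym (n%n≡0 m))

  edgeAt : ℕ → A × A
  edgeAt i = entry v i , entry v (suc i)

  edgeAt-% : ∀ i → edgeAt (i % m) ≡ edgeAt i
  edgeAt-% i = cong₂ _,_ (entry-cong (m%n%n≡m%n i m)) (entry-suc-% i)

  module _ (simple : IsSimple (edges (toList v ∷ʳ entry v 0))) where

    private
      cyclic-simple : IsSimple (applyUpTo edgeAt m)
      cyclic-simple = subst IsSimple (trans (cong edges toList-cyclic) (edges-applyUpTo (entry v) m)) simple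

      apart-% : ∀ {i j} → i % m < j % m → edgeAt i ≉ edgeAt j
      apart-% {i} {j} lt = subst₂ _≉_ (edgeAt-% i) (edgeAt-% j)
        (AllPairs-applyUpTo⁻ edgeAt m (proj₁ cyclic-simple) lt (m%n<n j m))

    edgeAt-injective : ∀ {i j} → SameEdge (edgeAt i) (edgeAt j) → i % m ≡ j % m
    edgeAt-injective {i} {j} same with <-cmp (i % m) (j % m)
    ... | tri< lt _ _ = ⊥-elim (apart-% lt same)
    ... | tri≈ _ eq _ = eq
    ... | tri> _ _ gt = ⊥-elim (≉-sym (apart-% gt) same)

    edgeAt-nonLoop : ∀ i → NonLoop (edgeAt i)
    edgeAt-nonLoop i = subst NonLoop (edgeAt-% i) (All.applyUpTo⁻ edgeAt m (proj₂ cyclic-simple) (m%n<n i m))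

closedTrail⇒isOS : ∀ {q m} {{_ : NonZero m}} (v : Vec (Fin q) m) →
                   IsSimple (edges (toList v ∷ʳ entry v 0)) → IsOSWith 2 v
closedTrail⇒isOS {m = m} v simple = unique , unoriented
  where
  open ≡-Reasoning

  unique : ∀ i j → window 2 v i ≡ window 2 v j → i % m ≡ j % m
  unique i j eq with Vec.∷-injective (trans (sym (window-2 v i)) (trans eq (window-2 v j)))
  ... | a≡c , b∷[]≡d∷[] = edgeAt-injective v simple (inj₁ (a≡c , Vec.∷-injectiveˡ b∷[]≡d∷[]))

  unoriented : ∀ i j → window 2 v i ≢ Vec.reverse (window 2 v j)
  unoriented i j eq with Vec.∷-injective (trans (sym (window-2 v i)) (trans eq (cong Vec.reverse (window-2 v j))))
  ... | a≡d , b∷[]≡c∷[] = edgeAt-nonLoop v simple i (begin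
    entry v i             ≡⟨ a≡d ⟩
    entry v (suc j)       ≡⟨ entry-suc-% v j ⟨
    entry v (suc (j % m)) ≡⟨ cong (entry v ∘ suc) i%m≡j%m ⟨
    entry v (suc (i % m)) ≡⟨ entry-suc-% v i ⟩
    entry v (suc i)       ∎)
    where
    i%m≡j%m : i % m ≡ j % m
    i%m≡j%m = edgeAt-injective v simple (inj₂ (a≡d , Vec.∷-injectiveˡ b∷[]≡c∷[]))

-- Relabelling vertices

module _ {A : Set} (_≟ᴬ_ : DecidableEquality A) where

  transpose : A → A → A → A
  transpose a b u with u ≟ᴬ a | u ≟ᴬ b
  ... | yes _ | _     = b
  ... | no _  | yes _ = a
  ... | no _  | no _  = u

  transpose-left : ∀ a b → transpose a b a ≡ b
  transpose-left a b with a ≟ᴬ a | a ≟ᴬ b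
  ... | yes _  | _ = refl
  ... | no a≢a | _ = ⊥-elim (a≢a refl)

  transpose-right : ∀ a b → transpose a b b ≡ a
  transpose-right a b with b ≟ᴬ a | b ≟ᴬ b
  ... | yes b≡a | _      = b≡a
  ... | no _    | yes _  = refl
  ... | no _    | no b≢b = ⊥-elim (b≢b refl)

  transpose-other : ∀ {a b u} → u ≢ a → u ≢ b → transpose a b u ≡ u
  transpose-other {a} {b} {u} u≢a u≢b with u ≟ᴬ a | u ≟ᴬ b
  ... | yes u≡a | _       = ⊥-elim (u≢a u≡a)
  ... | no _    | yes u≡b = ⊥-elim (u≢b u≡b)
  ... | no _    | no _    = refl

  transpose-involutive : ∀ a b u → transpose a b (transpose a b u) ≡ u
  transpose-involutive a b u with u ≟ᴬ a | u ≟ᴬ b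
  ... | yes refl | _        = transpose-right a b
  ... | no _     | yes refl = transpose-left a b
  ... | no u≢a   | no u≢b   = transpose-other u≢a u≢b

  transpose-injective : ∀ a b {u v} → transpose a b u ≡ transpose a b v → u ≡ v
  transpose-injective a b {u} {v} eq =
    trans (sym (transpose-involutive a b u)) (trans (cong (transpose a b) eq) (transpose-involutive a b v))

  transpose-preserves : ∀ {P : A → Set} {a b u} → P a → P b → P u → P (transpose a b u)
  transpose-preserves {a = a} {b} {u} Pa Pb Pu with u ≟ᴬ a | u ≟ᴬ b
  ... | yes _ | _     = Pb
  ... | no _  | yes _ = Pa
  ... | no _  | no _  = Pu

  record Relabelling (P : A → Set) (ps xs : List A) : Set where
    field
      σ         : A → A
      injective : ∀ {u v} → σ u ≡ σ v → u ≡ v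
      preserves : ∀ {u} → P u → P (σ u)
      sends     : map σ ps ≡ xs

  -- σ′ sends ps to xs; composing with the transposition of x and σ′ p also sends p to x, and it
  -- fixes xs = σ′ ps, which avoids x and, by injectivity, σ′ p.
  relabelling : ∀ {P : A → Set} {ps xs} → Unique ps → Unique xs → length ps ≡ length xs →
                All P ps → All P xs → Relabelling P ps xs
  relabelling {ps = []} {[]} _ _ _ _ _ = record { σ = id ; injective = id ; preserves = id ; sends = refl }
  relabelling {P} {p ∷ ps} {x ∷ xs} (p∉ps ∷ ps!) (x∉xs ∷ xs!) len (Pp ∷ Pps) (Px ∷ Pxs) = record
    { σ         = τ ∘ σ′.σ
    ; injective = σ′.injective ∘ transpose-injective x (σ′.σ p)
    ; preserves = λ Pu → transpose-preserves {P = P} Px (σ′.preserves Pp) (σ′.preserves Pu)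
    ; sends     = cong₂ _∷_ (transpose-right x (σ′.σ p)) (begin
        map (τ ∘ σ′.σ) ps   ≡⟨ map-∘ ps ⟩
        map τ (map σ′.σ ps) ≡⟨ cong (map τ) σ′.sends ⟩
        map τ xs            ≡⟨ map-id-local τ-fixes-xs ⟩
        xs                  ∎)
    }
    where
    open ≡-Reasoning
    module σ′ = Relabelling (relabelling ps! xs! (suc-injective len) Pps Pxs)

    τ : A → A
    τ = transpose x (σ′.σ p)

    σ′p∉xs : All (_≢ σ′.σ p) xs
    σ′p∉xs = subst (All (_≢ σ′.σ p)) σ′.sends
                   (All.map⁺ (All.map (λ p≢p′ → p≢p′ ∘ sym ∘ σ′.injective) p∉ps))

    τ-fixes-xs : All (λ u → τ u ≡ u) xs
    τ-fixes-xs = All.zipWith (λ (x≢u , u≢σ′p) → transpose-other (x≢u ∘ sym) u≢σ′p) (x∉xs , σ′p∉xs)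

finRelabelling : ∀ {q} {{_ : NonZero q}} {ps : List ℕ} {xs : List (Fin q)} → Unique ps → Unique xs →
                 length ps ≡ length xs → All (_< q) ps →
                 Σ (ℕ → Fin q) λ h → (∀ {u v} → u < q → v < q → h u ≡ h v → u ≡ v) × map h ps ≡ xs
finRelabelling {q} {ps = ps} {xs} ps-unique xs-unique len ps<q =
  (λ u → σ u mod q) , (λ u<q v<q → injective ∘ mod-injective (preserves u<q) (preserves v<q)) , (begin
    map (λ u → σ u mod q) ps   ≡⟨ map-∘ ps ⟩
    map (_mod q) (map σ ps)    ≡⟨ cong (map (_mod q)) sends ⟩
    map (_mod q) (map toℕ xs)  ≡⟨ map-∘ xs ⟨
    map (λ x → toℕ x mod q) xs ≡⟨ map-cong toℕ-mod xs ⟩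
    map id xs                  ≡⟨ map-id xs ⟩
    xs                         ∎)
  where
  open ≡-Reasoning
  open Relabelling (relabelling _≟_ ps-unique (Unique.map⁺ toℕ-injective xs-unique)
                                (trans len (sym (length-map toℕ xs))) ps<q (All.map⁺ (All.universal toℕ<n xs)))

-- Spokes and detours

-- x ∷ spokes x y L is the walk x, L, y, L − 1, x, L − 2, …, 1 ending at a hub; it joins every rim
-- vertex 1 … L to both hubs x and y.
spokes : ℕ → ℕ → ℕ → List ℕ
spokes x y zero    = []
spokes x y (suc L) = suc L ∷ y ∷ spokes y x L

Rim : ℕ → ℕ → Set
Rim L v = 0 < v × v ≤ L

0∉Rim : ∀ {L} → ∁ (Rim L) 0
0∉Rim (() , _)

>⇒∉Rim : ∀ {L v} → L < v → ∁ (Rim L) v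
>⇒∉Rim L<v (_ , v≤L) = <⇒≱ L<v v≤L

length-spokes : ∀ {x y} L → length (spokes x y L) ≡ L * 2
length-spokes zero    = refl
length-spokes (suc L) = cong (suc ∘ suc) (length-spokes L)

All-spokes : ∀ {P : ℕ → Set} {x y} L → P x → P y → (∀ {v} → Rim L v → P v) → All P (spokes x y L)
All-spokes zero    Px Py Prim = []
All-spokes (suc L) Px Py Prim =
  Prim (z<s , ≤-refl) ∷ Py ∷ All-spokes L Py Px (λ (0<v , v≤L) → Prim (0<v , m≤n⇒m≤1+n v≤L))

spokes-touch : ∀ {P : ℕ → Set} {x y} L → P x → P y → All (Any₂ P) (edges (x ∷ spokes x y L))
spokes-touch zero    Px Py = []
spokes-touch (suc L) Px Py = inj₁ Px ∷ inj₂ Py ∷ spokes-touch L Py Px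

spokes-touch-rim : ∀ {x y} L → All (Any₂ (Rim L)) (edges (x ∷ spokes x y L))
spokes-touch-rim zero    = []
spokes-touch-rim (suc L) = inj₂ (z<s , ≤-refl) ∷ inj₁ (z<s , ≤-refl) ∷ All.map widen (spokes-touch-rim L)
  where
  widen : ∀ {e} → Any₂ (Rim L) e → Any₂ (Rim (suc L)) e
  widen (inj₁ (0<u , u≤L)) = inj₁ (0<u , m≤n⇒m≤1+n u≤L)
  widen (inj₂ (0<w , w≤L)) = inj₂ (0<w , m≤n⇒m≤1+n w≤L)

spokes-simple : ∀ {x y} L → x ≢ y → L < x → L < y → IsSimple (edges (x ∷ spokes x y L))
spokes-simple zero    _   _   _   = [] , []
spokes-simple {x} {y} (suc L) x≢y L<x L<y =
  IsSimple-∷ (≢-sym (<⇒≢ L<x)) (hubs-apart ∷ All.map (endpoint-apart {P = _≡ suc L} (inj₂ refl)) avoid)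
    (IsSimple-∷ (<⇒≢ L<y) (All.map (endpoint-apart {P = _≡ suc L} (inj₁ refl)) avoid)
      (spokes-simple L (≢-sym x≢y) (<-trans (n<1+n L) L<y) (<-trans (n<1+n L) L<x)))
  where
  hubs-apart : (x , suc L) ≉ (suc L , y)
  hubs-apart = endpoint-apart {P = _≡ x} (inj₁ refl) (<⇒≢ L<x , ≢-sym x≢y)

  avoid : All (All₂ (_≢ suc L)) (edges (y ∷ spokes y x L))
  avoid = edges-All (≢-sym (<⇒≢ L<y) ∷ All-spokes L (≢-sym (<⇒≢ L<y)) (≢-sym (<⇒≢ L<x))
                                                   (λ (_ , v≤L) → <⇒≢ (s≤s v≤L)))

-- An even number of spokes returns to the hub x, from where the fan goes home to 0.
fan : ℕ → ℕ → ℕ → List ℕ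
fan x y k = (x ∷ spokes x y (k * 2)) ∷ʳ 0

edges-fan : ∀ {x y} k → edges (fan x y k) ≡ edges (x ∷ spokes x y (k * 2)) ∷ʳ (x , 0)
edges-fan zero    = refl
edges-fan {x} {y} (suc k) =
  cong (λ E → (x , 2 + k * 2) ∷ (2 + k * 2 , y) ∷ (y , 1 + k * 2) ∷ (1 + k * 2 , x) ∷ E) (edges-fan k)

fan-simple : ∀ {x y} k → x ≢ y → k * 2 < x → k * 2 < y → IsSimple (edges (fan x y k))
fan-simple k x≢y L<x L<y = subst IsSimple (sym (edges-fan k))
  (IsSimple-++ (spokes-simple (k * 2) x≢y L<x L<y)
               (IsSimple-∷ (≢-sym (<⇒≢ (≤-<-trans z≤n L<x))) [] ([] , []))
               (All.map (λ touches → endpoint-apart touches (>⇒∉Rim L<x , 0∉Rim) ∷ [])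
                        (spokes-touch-rim (k * 2))))

fan-apart : ∀ {x y} k {e} → All₂ (∁ (Rim (k * 2))) e → e ≉ (x , 0) → All (e ≉_) (edges (fan x y k))
fan-apart k {e} e∉Rim e≉x0 = subst (All (e ≉_)) (sym (edges-fan k))
  (All.++⁺ (All.map (λ touches → ≉-sym (endpoint-apart touches e∉Rim)) (spokes-touch-rim (k * 2)))
           (e≉x0 ∷ []))

fan-touch : ∀ {P : ℕ → Set} {x y} k → P x → P y → All (Any₂ P) (edges (fan x y k))
fan-touch k Px Py =
  subst (All (Any₂ _)) (sym (edges-fan k)) (All.++⁺ (spokes-touch (k * 2) Px Py) (inj₁ Px ∷ []))

record Detour (q : ℕ) : Set where
  field
    route   : List ℕ
    simple  : IsSimple (edges ((0 ∷ route) ∷ʳ 0))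
    new     : All (Any₂ (q ≤_)) (edges ((0 ∷ route) ∷ʳ 0))
    bounded : All (_< 2 + q) ((0 ∷ route) ∷ʳ 0)

oddDetour : ∀ k → Detour (suc (k * 2))
oddDetour k = record
  { route   = a ∷ b ∷ spokes b a L
  ; simple  = IsSimple-∷ (λ ()) (0a≉ab ∷ fan-apart k (0∉Rim , >⇒∉Rim L<a) 0a≉b0)
                (IsSimple-∷ a≢b (fan-apart k (>⇒∉Rim L<a , >⇒∉Rim L<b) ab≉b0)
                  (fan-simple k (≢-sym a≢b) L<b L<a))
  ; new     = inj₂ ≤-refl ∷ inj₁ ≤-refl ∷ fan-touch k (n≤1+n a) ≤-refl
  ; bounded = z<s ∷ a<2+q ∷ b<2+q ∷
                All.∷ʳ⁺ (All-spokes L b<2+q a<2+q (λ (_ , v≤L) → <-trans (s≤s v≤L) a<2+q)) z<s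
  }
  where
  L a b : ℕ
  L = k * 2
  a = suc L
  b = suc a

  L<a : L < a
  L<a = n<1+n L
  L<b : L < b
  L<b = <-trans L<a (n<1+n a)
  a≢b : a ≢ b
  a≢b = <⇒≢ (n<1+n a)
  b<2+q : b < 2 + a
  b<2+q = n<1+n b
  a<2+q : a < 2 + a
  a<2+q = <-trans (n<1+n a) b<2+q

  0a≉ab : (0 , a) ≉ (a , b)
  0a≉ab = endpoint-apart {P = _≡ 0} (inj₁ refl) ((λ ()) , (λ ()))
  0a≉b0 : (0 , a) ≉ (b , 0)
  0a≉b0 = endpoint-apart {P = _≡ a} (inj₂ refl) (≢-sym a≢b , (λ ()))
  ab≉b0 : (a , b) ≉ (b , 0)
  ab≉b0 = endpoint-apart {P = _≡ a} (inj₁ refl) (≢-sym a≢b , (λ ()))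

evenDetour : ∀ k → Detour (suc (suc (k * 2)))
evenDetour k = record
  { route   = a ∷ N ∷ b ∷ spokes b a L
  ; simple  = IsSimple-∷ (λ ()) (0a≉aN ∷ 0a≉Nb ∷ fan-apart k (0∉Rim , >⇒∉Rim L<a) 0a≉b0)
                (IsSimple-∷ a≢N (aN≉Nb ∷ fan-apart k (>⇒∉Rim L<a , >⇒∉Rim L<N) aN≉b0)
                  (IsSimple-∷ N≢b (fan-apart k (>⇒∉Rim L<N , >⇒∉Rim L<b) Nb≉b0)
                    (fan-simple k (≢-sym a≢b) L<b L<a)))
  ; new     = inj₂ ≤-refl ∷ inj₁ ≤-refl ∷ inj₂ (n≤1+n a) ∷ fan-touch k (n≤1+n a) ≤-refl
  ; bounded = z<s ∷ a<2+q ∷ N<2+q ∷ b<2+q ∷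
                All.∷ʳ⁺ (All-spokes L b<2+q a<2+q (λ (_ , v≤L) → <-trans (s≤s v≤L) N<2+q)) z<s
  }
  where
  L N a b : ℕ
  L = k * 2
  N = suc L
  a = suc N
  b = suc a

  L<N : L < N
  L<N = n<1+n L
  L<a : L < a
  L<a = <-trans L<N (n<1+n N)
  L<b : L < b
  L<b = <-trans L<a (n<1+n a)
  a≢b : a ≢ b
  a≢b = <⇒≢ (n<1+n a)
  a≢N : a ≢ N
  a≢N = ≢-sym (<⇒≢ (n<1+n N))
  N≢b : N ≢ b
  N≢b = <⇒≢ (<-trans (n<1+n N) (n<1+n a))
  b<2+q : b < 2 + a
  b<2+q = n<1+n b
  a<2+q : a < 2 + a
  a<2+q = <-trans (n<1+n a) b<2+q
  N<2+q : N < 2 + a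
  N<2+q = <-trans (n<1+n N) a<2+q

  0a≉aN : (0 , a) ≉ (a , N)
  0a≉aN = endpoint-apart {P = _≡ 0} (inj₁ refl) ((λ ()) , (λ ()))
  0a≉Nb : (0 , a) ≉ (N , b)
  0a≉Nb = endpoint-apart {P = _≡ 0} (inj₁ refl) ((λ ()) , (λ ()))
  0a≉b0 : (0 , a) ≉ (b , 0)
  0a≉b0 = endpoint-apart {P = _≡ a} (inj₂ refl) (≢-sym a≢b , (λ ()))
  aN≉Nb : (a , N) ≉ (N , b)
  aN≉Nb = endpoint-apart {P = _≡ a} (inj₁ refl) (≢-sym a≢N , ≢-sym a≢b)
  aN≉b0 : (a , N) ≉ (b , 0)
  aN≉b0 = endpoint-apart {P = _≡ a} (inj₁ refl) (≢-sym a≢b , (λ ()))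
  Nb≉b0 : (N , b) ≉ (b , 0)
  Nb≉b0 = endpoint-apart {P = _≡ N} (inj₁ refl) (≢-sym N≢b , (λ ()))

-- Closed trails of maximal length

record Circuit (q : ℕ) (pre : List ℕ) : Set where
  field
    rest : List ℕ

  walk : List ℕ
  walk = pre ++ rest

  field
    simple  : IsSimple (edges (walk ∷ʳ 0))
    bounded : All (_< q) (walk ∷ʳ 0)
    maximal : length walk ≡ maxPeriod q

extend : ∀ {q pre} (c : Circuit q pre) (d : Detour q) →
         maxPeriod (2 + q) ≡ maxPeriod q + length (0 ∷ Detour.route d) → Circuit (2 + q) pre
extend {q} {pre} c d grows = record
  { rest    = rest ++ 0 ∷ route
  ; simple  = subst (IsSimple ∘ edges) (sym spliced)
                (subst IsSimple (sym (edges-++ walk 0 (route ∷ʳ 0))) (IsSimple-++ c.simple d.simple old≉new))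
  ; bounded = subst (All (_< 2 + q)) (sym spliced)
                (All.++⁺ (All.map (λ v<q → ≤-trans v<q (m≤n+m q 2)) (All.++⁻ˡ walk c.bounded)) d.bounded)
  ; maximal = begin
      length (pre ++ rest ++ 0 ∷ route) ≡⟨ cong length (++-assoc pre rest (0 ∷ route)) ⟨
      length (walk ++ 0 ∷ route)        ≡⟨ length-++ walk ⟩
      length walk + length (0 ∷ route)  ≡⟨ cong (_+ length (0 ∷ route)) c.maximal ⟩
      maxPeriod q + length (0 ∷ route)  ≡⟨ grows ⟨
      maxPeriod (2 + q)                 ∎
  }
  where
  module c = Circuit c
  module d = Detour d
  open c using (rest; walk)
  open d using (route)
  open ≡-Reasoning

  spliced : (pre ++ rest ++ 0 ∷ route) ∷ʳ 0 ≡ walk ++ 0 ∷ (route ∷ʳ 0)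
  spliced = begin
    (pre ++ rest ++ 0 ∷ route) ∷ʳ 0 ≡⟨ cong (_∷ʳ 0) (++-assoc pre rest (0 ∷ route)) ⟨
    (walk ++ 0 ∷ route) ∷ʳ 0        ≡⟨ ++-assoc walk (0 ∷ route) (0 ∷ []) ⟩
    walk ++ 0 ∷ (route ∷ʳ 0)        ∎

  old≉new : All (λ e → All (e ≉_) (edges ((0 ∷ route) ∷ʳ 0))) (edges (walk ∷ʳ 0))
  old≉new = All.map (λ e<q → All.map (λ f-new → ≉-sym (endpoint-apart f-new e<q)) d.new)
                    (edges-All (All.map <⇒≱ c.bounded))

maxPeriod-odd : ∀ k → maxPeriod (suc (k * 2)) ≡ suc (k * 2) * k
maxPeriod-odd k rewrite [m+kn]%n≡m%n 1 k 2 ⦃ _ ⦄ =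
  trans (cong (_/ 2) (sym (*-assoc (suc (k * 2)) k 2))) (m*n/n≡m (suc (k * 2) * k) 2)

maxPeriod-even : ∀ k → maxPeriod (suc (suc (k * 2))) ≡ suc (suc (k * 2)) * k
maxPeriod-even k rewrite [m+kn]%n≡m%n 0 (suc k) 2 ⦃ _ ⦄ =
  trans (cong (_/ 2) (sym (*-assoc (suc (suc (k * 2))) k 2))) (m*n/n≡m (suc (suc (k * 2)) * k) 2)

oddCircuit : ∀ {pre} → Circuit 5 pre → ∀ t → Circuit (5 + t * 2) pre
oddCircuit c zero    = c
oddCircuit c (suc t) = extend (oddCircuit c t) (oddDetour k) (begin
  maxPeriod (suc (suc k * 2))       ≡⟨ maxPeriod-odd (suc k) ⟩
  suc (suc k * 2) * suc k           ≡⟨ arithmetic k ⟩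
  suc (k * 2) * k + (3 + k * 2 * 2) ≡⟨ cong₂ _+_ (maxPeriod-odd k) (cong (3 +_) (length-spokes (k * 2))) ⟨
  maxPeriod (suc (k * 2)) + length (0 ∷ Detour.route (oddDetour k)) ∎)
  where
  open ≡-Reasoning
  k : ℕ
  k = 2 + t
  arithmetic : ∀ k → suc (suc k * 2) * suc k ≡ suc (k * 2) * k + (3 + k * 2 * 2)
  arithmetic = solve-∀

evenCircuit : ∀ {pre} → Circuit 6 pre → ∀ t → Circuit (6 + t * 2) pre
evenCircuit c zero    = c
evenCircuit c (suc t) = extend (evenCircuit c t) (evenDetour k) (begin
  maxPeriod (suc (suc (suc k * 2)))       ≡⟨ maxPeriod-even (suc k) ⟩
  suc (suc (suc k * 2)) * suc k           ≡⟨ arithmetic k ⟩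
  suc (suc (k * 2)) * k + (4 + k * 2 * 2) ≡⟨ cong₂ _+_ (maxPeriod-even k) (cong (4 +_) (length-spokes (k * 2))) ⟨
  maxPeriod (suc (suc (k * 2))) + length (0 ∷ Detour.route (evenDetour k)) ∎)
  where
  open ≡-Reasoning
  k : ℕ
  k = 2 + t
  arithmetic : ∀ k → suc (suc (suc k * 2)) * suc k ≡ suc (suc (k * 2)) * k + (4 + k * 2 * 2)
  arithmetic = solve-∀

circuits : ∀ {pre} → Circuit 5 pre → Circuit 6 pre → ∀ n → Circuit (5 + n) pre
circuits {pre} c₅ c₆ n with n % 2 | m≡m%n+[m/n]*n n 2 | m%n<n n 2
... | 0           | n≡2t   | _ = subst (λ m → Circuit (5 + m) pre) (sym n≡2t) (oddCircuit c₅ (n / 2))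
... | 1           | n≡1+2t | _ = subst (λ m → Circuit (5 + m) pre) (sym n≡1+2t) (evenCircuit c₆ (n / 2))
... | suc (suc _) | _      | s<s (s<s ())

checkedCircuit : ∀ q pre rest
                 {simple  : True (isSimple? _≟_ (edges ((pre ++ rest) ∷ʳ 0)))}
                 {bounded : True (all? (_<? q) ((pre ++ rest) ∷ʳ 0))}
                 {maximal : True (length (pre ++ rest) ≟ maxPeriod q)} → Circuit q pre
checkedCircuit q pre rest {simple} {bounded} {maximal} = record
  { rest = rest ; simple = toWitness simple ; bounded = toWitness bounded ; maximal = toWitness maximal }

K₅-circuit₁ : Circuit 5 (0 ∷ 1 ∷ 2 ∷ 0 ∷ [])
K₅-circuit₁ = checkedCircuit 5 _ (3 ∷ 1 ∷ 4 ∷ 2 ∷ 3 ∷ 4 ∷ [])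

K₅-circuit₂ : Circuit 5 (0 ∷ 1 ∷ 2 ∷ 3 ∷ 1 ∷ [])
K₅-circuit₂ = checkedCircuit 5 _ (4 ∷ 2 ∷ 0 ∷ 3 ∷ 4 ∷ [])

K₆-circuit₁ : Circuit 6 (0 ∷ 1 ∷ 2 ∷ 0 ∷ [])
K₆-circuit₁ = checkedCircuit 6 _ (4 ∷ 2 ∷ 3 ∷ 1 ∷ 5 ∷ 3 ∷ 4 ∷ 5 ∷ [])

K₆-circuit₂ : Circuit 6 (0 ∷ 1 ∷ 2 ∷ 3 ∷ 1 ∷ [])
K₆-circuit₂ = checkedCircuit 6 _ (4 ∷ 0 ∷ 3 ∷ 5 ∷ 2 ∷ 4 ∷ 5 ∷ [])

-- Orientable sequences with a prescribed start

OSStartingWith : ∀ {q} → ℕ → List (Fin q) → Set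
OSStartingWith {q} m xs = Σ (Vec (Fin q) m) λ v → IsOS 2 v × ∃ λ rest → toList v ≡ xs ++ rest

circuit⇒orientable : ∀ {q pre} → Circuit q (0 ∷ pre) →
                     (h : ℕ → Fin q) → (∀ {u v} → u < q → v < q → h u ≡ h v → u ≡ v) →
                     OSStartingWith (maxPeriod q) (map h (0 ∷ pre))
circuit⇒orientable {q} {pre} c h h-injective =
  subst (λ m → OSStartingWith m (map h (0 ∷ pre))) (trans (length-map h walk) maximal)
        (v , (_ , closedTrail⇒isOS v v-simple) , map h rest ,
         trans (Vec.toList∘fromList (map h walk)) (map-++ h (0 ∷ pre) rest))
  where
  open Circuit c

  v : Vec (Fin q) (length (map h walk))
  v = fromList (map h walk)

  v-simple : IsSimple (edges (toList v ∷ʳ entry v 0))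
  v-simple = subst (λ w → IsSimple (edges (w ∷ʳ h 0))) (sym (Vec.toList∘fromList (map h walk)))
                   (subst (IsSimple ∘ edges) (map-++ h walk (0 ∷ [])) (IsSimple-map h-injective bounded simple))

orientable-xyzx : ∀ {q} {{_ : NonZero q}} → 2 < q → Circuit q (0 ∷ 1 ∷ 2 ∷ 0 ∷ []) →
                  ∀ {x y z : Fin q} → x ≢ y → y ≢ z → x ≢ z →
                  OSStartingWith (maxPeriod q) (x ∷ y ∷ z ∷ x ∷ [])
orientable-xyzx 2<q c x≢y y≢z x≢z =
  let h , h-injective , h≡xyz = finRelabelling
        (((λ ()) ∷ (λ ()) ∷ []) ∷ ((λ ()) ∷ []) ∷ [] ∷ [])
        ((x≢y ∷ x≢z ∷ []) ∷ (y≢z ∷ []) ∷ [] ∷ []) refl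
        (All.map (λ i≤2 → ≤-<-trans i≤2 2<q) (z≤n ∷ s≤s z≤n ∷ s≤s (s≤s z≤n) ∷ []))
      v , os , rest , v≡ = circuit⇒orientable c h h-injective
      h0≡x = ∷-injectiveˡ h≡xyz
  in  v , os , rest , trans v≡ (cong (_++ rest) (cong₂ _++_ h≡xyz (cong (_∷ []) h0≡x)))

orientable-wxyzx : ∀ {q} {{_ : NonZero q}} → 3 < q → Circuit q (0 ∷ 1 ∷ 2 ∷ 3 ∷ 1 ∷ []) →
                   ∀ {w x y z : Fin q} → toℕ w ≡ 0 → toℕ x ≢ 0 → toℕ y ≢ 0 → toℕ z ≢ 0 →
                   x ≢ y → y ≢ z → x ≢ z → OSStartingWith (maxPeriod q) (w ∷ x ∷ y ∷ z ∷ x ∷ [])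
orientable-wxyzx 3<q c w≡0 x≢0 y≢0 z≢0 x≢y y≢z x≢z =
  let h , h-injective , h≡wxyz = finRelabelling
        (((λ ()) ∷ (λ ()) ∷ (λ ()) ∷ []) ∷ ((λ ()) ∷ (λ ()) ∷ []) ∷ ((λ ()) ∷ []) ∷ [] ∷ [])
        ((w≢ x≢0 ∷ w≢ y≢0 ∷ w≢ z≢0 ∷ []) ∷ (x≢y ∷ x≢z ∷ []) ∷ (y≢z ∷ []) ∷ [] ∷ [])
        refl
        (All.map (λ i≤3 → ≤-<-trans i≤3 3<q)
                 (z≤n ∷ s≤s z≤n ∷ s≤s (s≤s z≤n) ∷ s≤s (s≤s (s≤s z≤n)) ∷ []))
      v , os , rest , v≡ = circuit⇒orientable c h h-injective
      h1≡x = ∷-injectiveˡ (∷-injectiveʳ h≡wxyz)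
  in  v , os , rest , trans v≡ (cong (_++ rest) (cong₂ _++_ h≡wxyz (cong (_∷ []) h1≡x)))
  where
  w≢ : ∀ {u} → toℕ u ≢ 0 → _ ≢ u
  w≢ u≢0 w≡u = u≢0 (trans (cong toℕ (sym w≡u)) w≡0)

lemma3p21 : (q : ℕ) → 4 < q → (x y z : Fin q) → x ≢ y → y ≢ z → x ≢ z
    → (Σ (Vec (Fin q) (maxPeriod q)) λ v → IsOS 2 v
         × (∃ λ rest → toList v ≡ x ∷ y ∷ z ∷ x ∷ rest))
      × (toℕ x ≢ 0 → toℕ y ≢ 0 → toℕ z ≢ 0
         → Σ (Vec (Fin q) (maxPeriod q)) λ v → IsOS 2 v
              × (∃ λ rest → ∃ λ w → toℕ w ≡ 0
                   × toList v ≡ w ∷ x ∷ y ∷ z ∷ x ∷ rest))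
lemma3p21 (suc (suc (suc (suc (suc n))))) _ x y z x≢y y≢z x≢z =
  orientable-xyzx (s≤s (s≤s (s≤s z≤n))) (circuits K₅-circuit₁ K₆-circuit₁ n) x≢y y≢z x≢z ,
  λ x≢0 y≢0 z≢0 →
    let v , os , rest , v≡ = orientable-wxyzx (s≤s (s≤s (s≤s (s≤s z≤n))))
                                              (circuits K₅-circuit₂ K₆-circuit₂ n)
                                              refl x≢0 y≢0 z≢0 x≢y y≢z x≢z
    in  v , os , rest , zero , refl , v≡
lemma3p21 (suc (suc (suc (suc zero)))) (s≤s (s≤s (s≤s (s≤s ()))))
lemma3p21 (suc (suc (suc zero)))       (s≤s (s≤s (s≤s ())))
lemma3p21 (suc (suc zero))             (s≤s (s≤s ()))
lemma3p21 (suc zero)                   (s≤s ())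
lemma3p21 zero                         ()
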